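{- $\mathbf{CL4}$ is a conservative extension of classical first-order logic: for every elementary $\mathbf{CL4}$-formula $F$, $F$ is valid in classical first-order logic if and only if $\mathbf{CL4}\vdash F$.
   Context: Fix the variables $v_1,v_2,\ldots$ and the constants $1,2,3,\ldots$; a term is a variable or a constant. The language of $\mathbf{CL4}$ has two sorts of letters, elementary and general, each letter $L$ having an arity $n\ge 0$, with infinitely many letters of each sort and arity. An atom is $L(t_1,\ldots,t_n)$ with $L$ an $n$-ary letter and $t_i$ terms; atoms inherit the sort of their letter. $\top$ and $\bot$ are two special $0$-ary elementary atoms called logical; all other letters are nonlogical. Formulas are built from atoms with $\neg$, the binary connectives $\wedge,\vee,\rightarrow,\sqcap,\sqcup$, and, for every variable $x$, the quantifiers $\forall x,\exists x$ (blind quantifiers) and $\sqcap x,\sqcup x$ (choice quantifiers). $F\rightarrow G$ is understood as $(\neg F)\vee G$ for polarity purposes; an occurrence is positive (resp. negative) if it is in the scope of an even (resp. odd) number of $\neg$. A surface occurrence is one not in the scope of any of $\sqcap,\sqcup,\sqcap x,\sqcup x$. A formula is elementary if it contains no $\sqcap,\sqcup,\sqcap x,\sqcup x$ and no general atoms; such a formula is a formula of classical first-order logic (elementary letters as predicate letters, constants as individual constants, $\top,\bot$ as truth and falsity, $\forall,\exists$ as the classical quantifiers). The elementarization of $F$ replaces every surface occurrence of the form $G\sqcap H$ or $\sqcap x G$ by $\top$, every surface occurrence of the form $G\sqcup H$ or $\sqcup x G$ by $\bot$, every positive surface occurrence of a general atom by $\bot$, and every negative surface occurrence of a general atom by $\top$.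 $F$ is stable if its elementarization is valid in classical first-order logic. Free occurrences are defined as usual (not in the scope of $\forall x,\exists x,\sqcap x,\sqcup x$), and $G(x/t)$ denotes the result of replacing all free occurrences of $x$ in $G$ by $t$. The system $\mathbf{CL4}$ has no explicit axioms and the following rules (a premise set may be empty): Rule (A): from a set $\vec H$ infer $F$, where $F$ is stable and (i) whenever $F$ has a positive (resp. negative) surface occurrence of $G_1\sqcap G_2$ (resp. $G_1\sqcup G_2$), for each $i\in\{1,2\}$, $\vec H$ contains the result of replacing that occurrence by $G_i$; (ii) whenever $F$ has a positive (resp. negative) surface occurrence of $\sqcap x G$ (resp. $\sqcup x G$), $\vec H$ contains the result of replacing that occurrence by $G(x/y)$ for some variable $y$ not occurring in $F$. Rule (B1): from $F'$ infer $F$, where $F'$ results from $F$ by replacing a negative (resp. positive) surface occurrence of $G_1\sqcap G_2$ (resp. $G_1\sqcup G_2$) by $G_i$ for some $i\in\{1,2\}$. Rule (B2): from $F'$ infer $F$, where $F'$ results from $F$ by replacing a negative (resp. positive) surface occurrence of $\sqcap x G$ (resp. $\sqcup x G$) by $G(x/t)$ for some term $t$ such that, if $t$ is a variable, neither that occurrence of $\sqcap xG$ (resp. $\sqcup xG$) within $F$ nor any free occurrence of $x$ within $G$ lies in the scope of $\forall t,\exists t,\sqcap t$ or $\sqcup t$. Rule (C): from $F'$ infer $F$, where $F'$ results from $F$ by replacing two surface occurrences — one positive and one negative — of some $n$-ary general letter by an $n$-ary nonlogical elementary letter not occurring in $F$. $\mathbf{CL4}\vdash F$ means $F$ is derivable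 by finitely many applications of these rules. -}

module Defs where

open import Data.Nat using (ℕ; _≡ᵇ_)
open import Data.Bool using (Bool; true; false; not; _∧_; _∨_; if_then_else_; T)
open import Data.Vec using (Vec; map)
open import Data.Vec.Relation.Unary.Any using () renaming (Any to VAny)
open import Data.Product using (_×_; Σ)
open import Data.Unit using (⊤)
open import Data.Empty using (⊥)
open import Relation.Nullary using (¬_)
open import Relation.Binary.PropositionalEquality using (_≡_)

data Term : Set where
  var   : ℕ → Term
  const : ℕ → Term

data Sort : Set where
  elementary general : Sort

-- A nonlogical letter is determined by its sort, arity n and an index k
-- (infinitely many letters of each sort and arity).  The logical atoms
-- ⊤ and ⊥ are separate constructors.
data Formula : Set where
  ⊤ᶠ ⊥ᶠ : Formula
  atom  : (s : Sort) (n k : ℕ) → Vec Term n → Formula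
  ¬ᶠ_   : Formula → Formula
  _∧ᶠ_ _∨ᶠ_ _⇒ᶠ_ _⊓_ _⊔_ : Formula → Formula → Formula
  ∀ᶠ ∃ᶠ ⊓ˣ ⊔ˣ : ℕ → Formula → Formula

IsElementary : Formula → Set
IsElementary ⊤ᶠ = ⊤
IsElementary ⊥ᶠ = ⊤
IsElementary (atom elementary n k ts) = ⊤
IsElementary (atom general n k ts) = ⊥
IsElementary (¬ᶠ F) = IsElementary F
IsElementary (F ∧ᶠ G) = IsElementary F × IsElementary G
IsElementary (F ∨ᶠ G) = IsElementary F × IsElementary G
IsElementary (F ⇒ᶠ G) = IsElementary F × IsElementary G
IsElementary (F ⊓ G) = ⊥
IsElementary (F ⊔ G) = ⊥
IsElementary (∀ᶠ x F) = IsElementary F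
IsElementary (∃ᶠ x F) = IsElementary F
IsElementary (⊓ˣ x F) = ⊥
IsElementary (⊔ˣ x F) = ⊥

termHasVar : ℕ → Term → Bool
termHasVar y (var z) = y ≡ᵇ z
termHasVar y (const c) = false

termsHaveVar : ∀ {n} → ℕ → Vec Term n → Bool
termsHaveVar y Vec.[] = false
termsHaveVar y (t Vec.∷ ts) = termHasVar y t ∨ termsHaveVar y ts

occursVar : ℕ → Formula → Bool
occursVar y ⊤ᶠ = false
occursVar y ⊥ᶠ = false
occursVar y (atom s n k ts) = termsHaveVar y ts
occursVar y (¬ᶠ F) = occursVar y F
occursVar y (F ∧ᶠ G) = occursVar y F ∨ occursVar y G
occursVar y (F ∨ᶠ G) = occursVar y F ∨ occursVar y G
occursVar y (F ⇒ᶠ G) = occursVar y F ∨ occursVar y G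
occursVar y (F ⊓ G) = occursVar y F ∨ occursVar y G
occursVar y (F ⊔ G) = occursVar y F ∨ occursVar y G
occursVar y (∀ᶠ z F) = (y ≡ᵇ z) ∨ occursVar y F
occursVar y (∃ᶠ z F) = (y ≡ᵇ z) ∨ occursVar y F
occursVar y (⊓ˣ z F) = (y ≡ᵇ z) ∨ occursVar y F
occursVar y (⊔ˣ z F) = (y ≡ᵇ z) ∨ occursVar y F

sortEq : Sort → Sort → Bool
sortEq elementary elementary = true
sortEq general general = true
sortEq _ _ = false

occursLetter : Sort → ℕ → ℕ → Formula → Bool
occursLetter s n k ⊤ᶠ = false
occursLetter s n k ⊥ᶠ = false
occursLetter s n k (atom s' n' k' ts) = sortEq s s' ∧ (n ≡ᵇ n') ∧ (k ≡ᵇ k')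
occursLetter s n k (¬ᶠ F) = occursLetter s n k F
occursLetter s n k (F ∧ᶠ G) = occursLetter s n k F ∨ occursLetter s n k G
occursLetter s n k (F ∨ᶠ G) = occursLetter s n k F ∨ occursLetter s n k G
occursLetter s n k (F ⇒ᶠ G) = occursLetter s n k F ∨ occursLetter s n k G
occursLetter s n k (F ⊓ G) = occursLetter s n k F ∨ occursLetter s n k G
occursLetter s n k (F ⊔ G) = occursLetter s n k F ∨ occursLetter s n k G
occursLetter s n k (∀ᶠ z F) = occursLetter s n k F
occursLetter s n k (∃ᶠ z F) = occursLetter s n k F
occursLetter s n k (⊓ˣ z F) = occursLetter s n k F
occursLetter s n k (⊔ˣ z F) = occursLetter s n k F

substTerm : ℕ → Term → Term → Term
substTerm x t (var z) = if x ≡ᵇ z then t else var z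
substTerm x t (const c) = const c

-- G(x/t): replace all free occurrences of x in G by t (literally, no renaming).
subst : ℕ → Term → Formula → Formula
subst x t ⊤ᶠ = ⊤ᶠ
subst x t ⊥ᶠ = ⊥ᶠ
subst x t (atom s n k ts) = atom s n k (map (substTerm x t) ts)
subst x t (¬ᶠ F) = ¬ᶠ subst x t F
subst x t (F ∧ᶠ G) = subst x t F ∧ᶠ subst x t G
subst x t (F ∨ᶠ G) = subst x t F ∨ᶠ subst x t G
subst x t (F ⇒ᶠ G) = subst x t F ⇒ᶠ subst x t G
subst x t (F ⊓ G) = subst x t F ⊓ subst x t G
subst x t (F ⊔ G) = subst x t F ⊔ subst x t G
subst x t (∀ᶠ z F) = if x ≡ᵇ z then ∀ᶠ z F else ∀ᶠ z (subst x t F)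
subst x t (∃ᶠ z F) = if x ≡ᵇ z then ∃ᶠ z F else ∃ᶠ z (subst x t F)
subst x t (⊓ˣ z F) = if x ≡ᵇ z then ⊓ˣ z F else ⊓ˣ z (subst x t F)
subst x t (⊔ˣ z F) = if x ≡ᵇ z then ⊔ˣ z F else ⊔ˣ z (subst x t F)

occursFree : ℕ → Formula → Bool
occursFree x ⊤ᶠ = false
occursFree x ⊥ᶠ = false
occursFree x (atom s n k ts) = termsHaveVar x ts
occursFree x (¬ᶠ F) = occursFree x F
occursFree x (F ∧ᶠ G) = occursFree x F ∨ occursFree x G
occursFree x (F ∨ᶠ G) = occursFree x F ∨ occursFree x G
occursFree x (F ⇒ᶠ G) = occursFree x F ∨ occursFree x G
occursFree x (F ⊓ G) = occursFree x F ∨ occursFree x G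
occursFree x (F ⊔ G) = occursFree x F ∨ occursFree x G
occursFree x (∀ᶠ z F) = not (x ≡ᵇ z) ∧ occursFree x F
occursFree x (∃ᶠ z F) = not (x ≡ᵇ z) ∧ occursFree x F
occursFree x (⊓ˣ z F) = not (x ≡ᵇ z) ∧ occursFree x F
occursFree x (⊔ˣ z F) = not (x ≡ᵇ z) ∧ occursFree x F

-- freeUnder x y G: some free occurrence of x in G lies in the scope of
-- ∀y, ∃y, ⊓y or ⊔y (within G).
freeUnder : ℕ → ℕ → Formula → Bool
freeUnder x y ⊤ᶠ = false
freeUnder x y ⊥ᶠ = false
freeUnder x y (atom s n k ts) = false
freeUnder x y (¬ᶠ F) = freeUnder x y F
freeUnder x y (F ∧ᶠ G) = freeUnder x y F ∨ freeUnder x y G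
freeUnder x y (F ∨ᶠ G) = freeUnder x y F ∨ freeUnder x y G
freeUnder x y (F ⇒ᶠ G) = freeUnder x y F ∨ freeUnder x y G
freeUnder x y (F ⊓ G) = freeUnder x y F ∨ freeUnder x y G
freeUnder x y (F ⊔ G) = freeUnder x y F ∨ freeUnder x y G
freeUnder x y (∀ᶠ z F) = not (x ≡ᵇ z) ∧ ((y ≡ᵇ z) ∧ occursFree x F ∨ freeUnder x y F)
freeUnder x y (∃ᶠ z F) = not (x ≡ᵇ z) ∧ ((y ≡ᵇ z) ∧ occursFree x F ∨ freeUnder x y F)
freeUnder x y (⊓ˣ z F) = not (x ≡ᵇ z) ∧ ((y ≡ᵇ z) ∧ occursFree x F ∨ freeUnder x y F)
freeUnder x y (⊔ˣ z F) = not (x ≡ᵇ z) ∧ ((y ≡ᵇ z) ∧ occursFree x F ∨ freeUnder x y F)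

-- A surface context is a formula with one hole that is not in the scope
-- of any choice operator.
data Ctx : Set where
  hole : Ctx
  ¬c   : Ctx → Ctx
  ∧l ∨l ⇒l : Ctx → Formula → Ctx
  ∧r ∨r ⇒r : Formula → Ctx → Ctx
  ∀c ∃c : ℕ → Ctx → Ctx

plug : Ctx → Formula → Formula
plug hole F = F
plug (¬c C) F = ¬ᶠ plug C F
plug (∧l C G) F = plug C F ∧ᶠ G
plug (∨l C G) F = plug C F ∨ᶠ G
plug (⇒l C G) F = plug C F ⇒ᶠ G
plug (∧r G C) F = G ∧ᶠ plug C F
plug (∨r G C) F = G ∨ᶠ plug C F
plug (⇒r G C) F = G ⇒ᶠ plug C F
plug (∀c x C) F = ∀ᶠ x (plug C F)
plug (∃c x C) F = ∃ᶠ x (plug C F)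

-- true = the hole is a positive occurrence; F → G counts as (¬F) ∨ G.
positive : Ctx → Bool
positive hole = true
positive (¬c C) = not (positive C)
positive (∧l C G) = positive C
positive (∨l C G) = positive C
positive (⇒l C G) = not (positive C)
positive (∧r G C) = positive C
positive (∨r G C) = positive C
positive (⇒r G C) = positive C
positive (∀c x C) = positive C
positive (∃c x C) = positive C

ctxBinds : ℕ → Ctx → Bool
ctxBinds y hole = false
ctxBinds y (¬c C) = ctxBinds y C
ctxBinds y (∧l C G) = ctxBinds y C
ctxBinds y (∨l C G) = ctxBinds y C
ctxBinds y (⇒l C G) = ctxBinds y C
ctxBinds y (∧r G C) = ctxBinds y C
ctxBinds y (∨r G C) = ctxBinds y C
ctxBinds y (⇒r G C) = ctxBinds y C
ctxBinds y (∀c x C) = (y ≡ᵇ x) ∨ ctxBinds y C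
ctxBinds y (∃c x C) = (y ≡ᵇ x) ∨ ctxBinds y C

-- side condition of rule (B2) on the term t
B2-ok : Ctx → ℕ → Formula → Term → Set
B2-ok C x G (var y) = (ctxBinds y C ≡ false) × (freeUnder x y G ≡ false)
B2-ok C x G (const c) = ⊤

-- elem p F: elementarization of F where p says whether F itself stands
-- in positive position.
elem : Bool → Formula → Formula
elem p ⊤ᶠ = ⊤ᶠ
elem p ⊥ᶠ = ⊥ᶠ
elem p (atom elementary n k ts) = atom elementary n k ts
elem p (atom general n k ts) = if p then ⊥ᶠ else ⊤ᶠ
elem p (¬ᶠ F) = ¬ᶠ elem (not p) F
elem p (F ∧ᶠ G) = elem p F ∧ᶠ elem p G
elem p (F ∨ᶠ G) = elem p F ∨ᶠ elem p G
elem p (F ⇒ᶠ G) = elem (not p) F ⇒ᶠ elem p G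
elem p (F ⊓ G) = ⊤ᶠ
elem p (F ⊔ G) = ⊥ᶠ
elem p (∀ᶠ x F) = ∀ᶠ x (elem p F)
elem p (∃ᶠ x F) = ∃ᶠ x (elem p F)
elem p (⊓ˣ x F) = ⊤ᶠ
elem p (⊔ˣ x F) = ⊥ᶠ

elementarization : Formula → Formula
elementarization = elem true

-- Classical first-order semantics (Tarski), read classically:
-- atoms are two-valued, ∨ and ∃ are interpreted classically
-- (as ¬(¬A × ¬B) and ¬∀¬), so every truth value is ¬¬-stable.

record Structure : Set₁ where
  field
    Dom    : Set
    point  : Dom                           -- domains are nonempty
    constI : ℕ → Dom
    relI   : (n k : ℕ) → Vec Dom n → Bool

module _ (M : Structure) where
  open Structure M

  Assignment : Set
  Assignment = ℕ → Dom

  update : Assignment → ℕ → Dom → Assignment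
  update ρ x d z = if x ≡ᵇ z then d else ρ z

  evalT : Assignment → Term → Dom
  evalT ρ (var z) = ρ z
  evalT ρ (const c) = constI c

  -- Truth is only meaningful for elementary formulas; general atoms and
  -- choice operators (which never occur in elementary formulas) get ⊥.
  Sat : Assignment → Formula → Set
  Sat ρ ⊤ᶠ = ⊤
  Sat ρ ⊥ᶠ = ⊥
  Sat ρ (atom elementary n k ts) = T (relI n k (map (evalT ρ) ts))
  Sat ρ (atom general n k ts) = ⊥
  Sat ρ (¬ᶠ F) = ¬ Sat ρ F
  Sat ρ (F ∧ᶠ G) = Sat ρ F × Sat ρ G
  Sat ρ (F ∨ᶠ G) = ¬ (¬ Sat ρ F × ¬ Sat ρ G)
  Sat ρ (F ⇒ᶠ G) = Sat ρ F → Sat ρ G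
  Sat ρ (F ⊓ G) = ⊥
  Sat ρ (F ⊔ G) = ⊥
  Sat ρ (∀ᶠ x F) = (d : Dom) → Sat (update ρ x d) F
  Sat ρ (∃ᶠ x F) = ¬ ((d : Dom) → ¬ Sat (update ρ x d) F)
  Sat ρ (⊓ˣ x F) = ⊥
  Sat ρ (⊔ˣ x F) = ⊥

Valid : Formula → Set₁
Valid F = (M : Structure) (ρ : Assignment M) → Sat M ρ F

Stable : Formula → Set₁
Stable F = Valid (elementarization F)

data CL4⊢_ : Formula → Set₁ where
  ruleA : ∀ {F} → Stable F →
    (∀ C G₁ G₂ → F ≡ plug C (G₁ ⊓ G₂) → positive C ≡ true →
       (CL4⊢ plug C G₁) × (CL4⊢ plug C G₂)) →
    (∀ C G₁ G₂ → F ≡ plug C (G₁ ⊔ G₂) → positive C ≡ false →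
       (CL4⊢ plug C G₁) × (CL4⊢ plug C G₂)) →
    (∀ C x G → F ≡ plug C (⊓ˣ x G) → positive C ≡ true →
       Σ ℕ λ y → (occursVar y F ≡ false) × (CL4⊢ plug C (subst x (var y) G))) →
    (∀ C x G → F ≡ plug C (⊔ˣ x G) → positive C ≡ false →
       Σ ℕ λ y → (occursVar y F ≡ false) × (CL4⊢ plug C (subst x (var y) G))) →
    CL4⊢ F
  ruleB1⊓ : ∀ C G₁ G₂ (i : Bool) → positive C ≡ false →
    CL4⊢ plug C (if i then G₁ else G₂) → CL4⊢ plug C (G₁ ⊓ G₂)
  ruleB1⊔ : ∀ C G₁ G₂ (i : Bool) → positive C ≡ true →
    CL4⊢ plug C (if i then G₁ else G₂) → CL4⊢ plug C (G₁ ⊔ G₂)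
  ruleB2⊓ : ∀ C x G t → positive C ≡ false → B2-ok C x G t →
    CL4⊢ plug C (subst x t G) → CL4⊢ plug C (⊓ˣ x G)
  ruleB2⊔ : ∀ C x G t → positive C ≡ true → B2-ok C x G t →
    CL4⊢ plug C (subst x t G) → CL4⊢ plug C (⊔ˣ x G)
  -- (C): C₁ and C₂ are two distinct surface positions of F (C₂ is a surface
  -- position of the formula after the first replacement, which is a
  -- different position since the general atom at C₁ is gone) with opposite
  -- polarities, both holding the general letter (n, k); the fresh
  -- elementary letter (n, k') does not occur in F.
  ruleC : ∀ C₁ C₂ n k k' (ts₁ ts₂ : Vec Term n) F →
    F ≡ plug C₁ (atom general n k ts₁) →
    plug C₁ (atom elementary n k' ts₁) ≡ plug C₂ (atom general n k ts₂) →
    positive C₁ ≡ not (positive C₂) →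
    occursLetter elementary n k' F ≡ false →
    CL4⊢ plug C₂ (atom elementary n k' ts₂) → CL4⊢ F

-- An elementary formula is its own elementarization, so for it stability is
-- classical validity.  It also has no surface occurrence of a choice operator
-- or of a general atom: hence rule (A) applied to it needs no premises, and
-- none of the rules (B1), (B2), (C) can have it as conclusion.  Derivability
-- of an elementary formula therefore means exactly one premise-free use of
-- (A), i.e. validity.
module Submission where

open import Defs
open import Data.Product using (_×_; _,_)
open import Data.Bool using (true)
open import Data.Empty using (⊥-elim)
open import Relation.Binary.PropositionalEquality using (_≡_; refl; sym; cong; cong₂)
  renaming (subst to transport)

elem-elementary : ∀ p F → IsElementary F → elem p F ≡ F
elem-elementary p ⊤ᶠ       _       = refl
elem-elementary p ⊥ᶠ       _       = refl
elem-elementary p (atom elementary n k ts) _ = refl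
elem-elementary p (¬ᶠ F)   e       = cong ¬ᶠ_ (elem-elementary _ F e)
elem-elementary p (F ∧ᶠ G) (e , f) = cong₂ _∧ᶠ_ (elem-elementary p F e) (elem-elementary p G f)
elem-elementary p (F ∨ᶠ G) (e , f) = cong₂ _∨ᶠ_ (elem-elementary p F e) (elem-elementary p G f)
elem-elementary p (F ⇒ᶠ G) (e , f) = cong₂ _⇒ᶠ_ (elem-elementary _ F e) (elem-elementary p G f)
elem-elementary p (∀ᶠ x F) e       = cong (∀ᶠ x) (elem-elementary p F e)
elem-elementary p (∃ᶠ x F) e       = cong (∃ᶠ x) (elem-elementary p F e)

stable⇒valid : ∀ F → IsElementary F → Stable F → Valid F
stable⇒valid F e = transport Valid (elem-elementary true F e)

valid⇒stable : ∀ F → IsElementary F → Valid F → Stable F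
valid⇒stable F e = transport Valid (sym (elem-elementary true F e))

isElementary-plug⁻ : ∀ C X → IsElementary (plug C X) → IsElementary X
isElementary-plug⁻ hole      X e       = e
isElementary-plug⁻ (¬c C)    X e       = isElementary-plug⁻ C X e
isElementary-plug⁻ (∧l C G)  X (e , _) = isElementary-plug⁻ C X e
isElementary-plug⁻ (∨l C G)  X (e , _) = isElementary-plug⁻ C X e
isElementary-plug⁻ (⇒l C G)  X (e , _) = isElementary-plug⁻ C X e
isElementary-plug⁻ (∧r G C)  X (_ , e) = isElementary-plug⁻ C X e
isElementary-plug⁻ (∨r G C)  X (_ , e) = isElementary-plug⁻ C X e
isElementary-plug⁻ (⇒r G C)  X (_ , e) = isElementary-plug⁻ C X e
isElementary-plug⁻ (∀c x C)  X e       = isElementary-plug⁻ C X e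
isElementary-plug⁻ (∃c x C)  X e       = isElementary-plug⁻ C X e

isElementary-surface : ∀ {F} C X → F ≡ plug C X → IsElementary F → IsElementary X
isElementary-surface C X refl = isElementary-plug⁻ C X

-- IsElementary of a choice formula or of a general atom reduces to ⊥; that is
-- what every ⊥-elim below refutes.
soundness : ∀ {F} → IsElementary F → CL4⊢ F → Valid F
soundness {F} e (ruleA stable _ _ _ _) = stable⇒valid F e stable
soundness e (ruleB1⊓ C G₁ G₂ _ _ _)    = ⊥-elim (isElementary-plug⁻ C (G₁ ⊓ G₂) e)
soundness e (ruleB1⊔ C G₁ G₂ _ _ _)    = ⊥-elim (isElementary-plug⁻ C (G₁ ⊔ G₂) e)
soundness e (ruleB2⊓ C x G _ _ _ _)    = ⊥-elim (isElementary-plug⁻ C (⊓ˣ x G) e)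
soundness e (ruleB2⊔ C x G _ _ _ _)    = ⊥-elim (isElementary-plug⁻ C (⊔ˣ x G) e)
soundness e (ruleC C₁ _ n k _ ts₁ _ _ F≡ _ _ _ _) =
  ⊥-elim (isElementary-surface C₁ (atom general n k ts₁) F≡ e)

completeness : ∀ F → IsElementary F → Valid F → CL4⊢ F
completeness F e valid = ruleA (valid⇒stable F e valid)
  (λ C G₁ G₂ F≡ _ → ⊥-elim (isElementary-surface C (G₁ ⊓ G₂) F≡ e))
  (λ C G₁ G₂ F≡ _ → ⊥-elim (isElementary-surface C (G₁ ⊔ G₂) F≡ e))
  (λ C x G F≡ _ → ⊥-elim (isElementary-surface C (⊓ˣ x G) F≡ e))
  (λ C x G F≡ _ → ⊥-elim (isElementary-surface C (⊔ˣ x G) F≡ e))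

proposition7p2 : (F : Formula) → IsElementary F →
    (Valid F → CL4⊢ F) × (CL4⊢ F → Valid F)
proposition7p2 F e = completeness F e , soundness e
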